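{- Let $r,l$ be positive integers with $2r-2\geq l \geq r$. If $G$ is a graph on $n$ vertices with minimum degree $\delta(G)\geq n-\left\lceil\frac{l-r+1}{l} n\right\rceil+(l-r)+1$ and $A_0 \subseteq V(G)$ with $|A_0|=l$, then $A_0$ is $r$-percolating.
   Context: In the $r$-neighbour bootstrap process on a graph $G$ with initially infected set $A_0\subseteq V(G)$, one sets $A_t=A_{t-1}\cup\{v\in V(G): |N(v)\cap A_{t-1}|\geq r\}$ for $t\geq 1$; $A_0$ is $r$-percolating if $A_t=V(G)$ for some $t$. -}

module Defs where

open import Data.Nat using (ℕ; zero; suc; _+_; _*_; _∸_; _≤_; NonZero)
open import Data.Nat.DivMod using (_/_)
open import Data.Bool using (Bool; true; false; _∧_; _∨_; not; if_then_else_)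
open import Data.Fin using (Fin)
open import Data.Vec using (Vec; lookup; tabulate; count)
open import Data.List using (List; allFin; filter; length)
open import Data.Product using (∃; _×_)
open import Relation.Binary.PropositionalEquality using (_≡_)
open import Relation.Nullary using (¬_)
open import Data.Fin.Subset using (Subset; _∈_; ⊤; ∣_∣)

record Graph (n : ℕ) : Set where
  field
    adj   : Fin n → Fin n → Bool
    sym   : ∀ u v → adj u v ≡ adj v u
    irrefl : ∀ v → adj v v ≡ false
open Graph public

countWhere : {n : ℕ} → (Fin n → Bool) → ℕ
countWhere {n} p = length (filter (λ w → Data.Bool._≟_ (p w) true) (allFin n))

degree : {n : ℕ} → Graph n → Fin n → ℕ
degree G v = countWhere (adj G v)

minDegree≥ : {n : ℕ} → Graph n → ℕ → Set
minDegree≥ G d = ∀ v → d ≤ degree G v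

nbrsIn : {n : ℕ} → Graph n → Subset n → Fin n → ℕ
nbrsIn G A v = countWhere (λ w → adj G v w ∧ lookup A w)

_≤ᵇ'_ : ℕ → ℕ → Bool
zero ≤ᵇ' _ = true
suc m ≤ᵇ' zero = false
suc m ≤ᵇ' suc k = m ≤ᵇ' k

step : {n : ℕ} → Graph n → ℕ → Subset n → Subset n
step G r A = tabulate (λ v → lookup A v ∨ (r ≤ᵇ' nbrsIn G A v))

infected : {n : ℕ} → Graph n → ℕ → Subset n → ℕ → Subset n
infected G r A zero = A
infected G r A (suc t) = step G r (infected G r A t)

Percolates : {n : ℕ} → Graph n → ℕ → Subset n → Set
Percolates G r A = ∃ λ t → infected G r A t ≡ ⊤

ceilDiv : (a b : ℕ) → .{{NonZero b}} → ℕ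
ceilDiv a b = (a + (b ∸ 1)) / b

module Submission where

-- Write r = p + 1 and k = l - r + 1, so that l = k + p, and k ≤ p because
-- l ≤ 2r - 2.  The bootstrap process only ever adds vertices, and it adds at
-- least one as long as some uninfected vertex has r infected neighbours; hence
-- within n steps it reaches a closed set B ⊇ A₀, i.e. one where every vertex
-- outside B has at most p neighbours in B.  It then suffices to show that a
-- closed set B with |B| ≥ l is all of V(G).  If some w ∉ B, put b = |B|,
-- m = n - b and D = δ + 1.  Double counting the edges between B and its
-- complement gives  b·(D - b) ≤ p·m,  the vertex w gives  D ≤ p + m,  and the
-- degree hypothesis becomes  p·n + l·k < l·D.  These are incompatible with
-- l ≤ b (split on whether b + k ≤ D).

open import Defs
open import Data.Nat using (ℕ; zero; suc; _+_; _*_; _∸_; _≤_; _<_; _≤?_; z≤n; s≤s; s≤s⁻¹; NonZero)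
open import Data.Nat.Properties
open import Data.Nat.DivMod using (m/n*n≤m)
open import Data.Nat.Tactic.RingSolver using (solve)
open import Data.Bool using (Bool; true; false; _∧_; _∨_; not)
import Data.Bool as Bool
open import Data.Bool.Properties using (∨-zeroʳ; ¬-not; not-injective)
open import Data.Fin using (Fin; zero; suc)
open import Data.Fin.Properties using (any?)
open import Data.Fin.Subset using (Subset; ∣_∣; ⊤; _∈_; _∉_; _⊆_; _⊂_)
open import Data.Fin.Subset.Properties using (p⊂q⇒∣p∣<∣q∣; p⊆q⇒∣p∣≤∣q∣; ∣p∣≤n; ⊆-refl; ⊆-trans; ⊆-antisym; ⊆⊤)
import Data.Vec as Vec
open import Data.Vec using (lookup)
open import Data.Vec.Properties using (lookup∘tabulate; []=⇒lookup; lookup⇒[]=)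
open import Data.List using (_∷_; []; filter; length)
import Data.List as List
open import Data.Product using (∃; _,_)
open import Data.Sum using (_⊎_; inj₁; inj₂)
open import Data.Empty using (⊥; ⊥-elim)
open import Function using (_∘_; id)
open import Relation.Nullary.Decidable using (yes; no; _×-dec_)
open import Relation.Binary.PropositionalEquality using (_≡_; refl; cong; subst; module ≡-Reasoning)
import Relation.Binary.PropositionalEquality as ≡
open import Algebra.Properties.Semiring.Sum +-*-semiring
  using (sum; ∑-distrib-+; ∑-comm; *-distribˡ-sum; *-distribʳ-sum; sum-cong-≗)

𝟙 : Bool → ℕ
𝟙 true  = 1
𝟙 false = 0

size : ∀ {n} → (Fin n → Bool) → ℕ
size q = sum (𝟙 ∘ q)

sum-mono : ∀ {n} {f g : Fin n → ℕ} → (∀ i → f i ≤ g i) → sum f ≤ sum g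
sum-mono {zero}  _   = z≤n
sum-mono {suc n} f≤g = +-mono-≤ (f≤g zero) (sum-mono (f≤g ∘ suc))

sum-mono-< : ∀ {n} {f g : Fin n → ℕ} → (∀ i → f i ≤ g i) → ∀ v → f v < g v → sum f < sum g
sum-mono-< f≤g zero    fv<gv = +-mono-<-≤ fv<gv (sum-mono (f≤g ∘ suc))
sum-mono-< f≤g (suc v) fv<gv = +-mono-≤-< (f≤g zero) (sum-mono-< (f≤g ∘ suc) v fv<gv)

sum-ones : ∀ {n} → sum {n} (λ _ → 1) ≡ n
sum-ones {zero}  = refl
sum-ones {suc n} = cong suc (sum-ones {n})

𝟙-split : ∀ a c → 𝟙 a ≡ 𝟙 (a ∧ c) + 𝟙 (a ∧ not c)
𝟙-split false c     = refl
𝟙-split true  true  = refl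
𝟙-split true  false = refl

𝟙-∧-≤ : ∀ a c → 𝟙 (a ∧ c) ≤ 𝟙 c
𝟙-∧-≤ true  c = ≤-refl
𝟙-∧-≤ false c = z≤n

𝟙-guard : ∀ a {x y} → (a ≡ true → x ≤ y) → 𝟙 a * x ≤ 𝟙 a * y
𝟙-guard true  x≤y = *-monoʳ-≤ 1 (x≤y refl)
𝟙-guard false _   = z≤n

-- [a]·[c ∧ ¬b] = [¬b]·[c ∧ a]: a cross edge counted from either endpoint.
𝟙-swap : ∀ a b c → 𝟙 a * 𝟙 (c ∧ not b) ≡ 𝟙 (not b) * 𝟙 (c ∧ a)
𝟙-swap true  true  true  = refl
𝟙-swap true  true  false = refl
𝟙-swap true  false true  = refl
𝟙-swap true  false false = refl
𝟙-swap false true  true  = refl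
𝟙-swap false true  false = refl
𝟙-swap false false true  = refl
𝟙-swap false false false = refl

size-complement : ∀ {n} (q : Fin n → Bool) → size q + size (not ∘ q) ≡ n
size-complement {n} q = begin
  size q + size (not ∘ q)            ≡⟨ ∑-distrib-+ (𝟙 ∘ q) (𝟙 ∘ not ∘ q) ⟨
  sum (λ i → 𝟙 (q i) + 𝟙 (not (q i))) ≡⟨ sum-cong-≗ {n} (λ i → ≡.sym (𝟙-split true (q i))) ⟩
  sum {n} (λ _ → 1)                  ≡⟨ sum-ones {n} ⟩
  n                                  ∎
  where open ≡-Reasoning

length-filter-tabulate : ∀ {A : Set} {n} (P : A → Bool) (f : Fin n → A) →
  length (filter (λ a → P a Bool.≟ true) (List.tabulate f)) ≡ size (P ∘ f)
length-filter-tabulate {n = zero}  P f = refl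
length-filter-tabulate {n = suc n} P f with P (f zero)
... | true  = cong suc (length-filter-tabulate P (f ∘ suc))
... | false = length-filter-tabulate P (f ∘ suc)

countWhere≡size : ∀ {n} (q : Fin n → Bool) → countWhere q ≡ size q
countWhere≡size q = length-filter-tabulate q id

∣∣≡size : ∀ {n} (A : Subset n) → ∣ A ∣ ≡ size (lookup A)
∣∣≡size Vec.[]            = refl
∣∣≡size (true  Vec.∷ A) = cong suc (∣∣≡size A)
∣∣≡size (false Vec.∷ A) = ∣∣≡size A

lookup-false⇒∉ : ∀ {n} {A : Subset n} {v} → lookup A v ≡ false → v ∉ A
lookup-false⇒∉ v∉A v∈A with () ← ≡.trans (≡.sym ([]=⇒lookup v∈A)) v∉A

≤ᵇ'-complete : ∀ {r x} → r ≤ x → (r ≤ᵇ' x) ≡ true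
≤ᵇ'-complete z≤n       = refl
≤ᵇ'-complete (s≤s r≤x) = ≤ᵇ'-complete r≤x

-- A set is closed for the r-neighbour rule if no vertex outside it has r
-- neighbours inside it; closed sets are where the process stops.
Closed : ∀ {n} → Graph n → ℕ → Subset n → Set
Closed G r B = ∀ v → lookup B v ≡ false → nbrsIn G B v < r

module Dynamics {n : ℕ} (G : Graph n) (r : ℕ) where

  step-lookup : ∀ A v → lookup (step G r A) v ≡ (lookup A v ∨ (r ≤ᵇ' nbrsIn G A v))
  step-lookup A v = lookup∘tabulate (λ u → lookup A u ∨ (r ≤ᵇ' nbrsIn G A u)) v

  step-inflationary : ∀ {A} → A ⊆ step G r A
  step-inflationary {A} {v} v∈A = lookup⇒[]= v (step G r A) (begin
    lookup (step G r A) v                 ≡⟨ step-lookup A v ⟩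
    lookup A v ∨ (r ≤ᵇ' nbrsIn G A v)     ≡⟨ cong (_∨ (r ≤ᵇ' nbrsIn G A v)) ([]=⇒lookup v∈A) ⟩
    true                                  ∎)
    where open ≡-Reasoning

  step-threshold : ∀ {A v} → r ≤ nbrsIn G A v → v ∈ step G r A
  step-threshold {A} {v} r≤ = lookup⇒[]= v (step G r A) (begin
    lookup (step G r A) v                 ≡⟨ step-lookup A v ⟩
    lookup A v ∨ (r ≤ᵇ' nbrsIn G A v)     ≡⟨ cong (lookup A v ∨_) (≤ᵇ'-complete r≤) ⟩
    lookup A v ∨ true                     ≡⟨ ∨-zeroʳ (lookup A v) ⟩
    true                                  ∎)
    where open ≡-Reasoning

  closed-or-grows : ∀ A → Closed G r A ⊎ A ⊂ step G r A
  closed-or-grows A with any? (λ v → (lookup A v Bool.≟ false) ×-dec (r ≤? nbrsIn G A v))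
  ... | yes (v , v∉A , r≤) = inj₂ (step-inflationary {A} , v , step-threshold {A} r≤ , lookup-false⇒∉ {A = A} v∉A)
  ... | no none             = inj₁ (λ v v∉A → ≰⇒> (λ r≤ → none (v , v∉A , r≤)))

  infected-⊇ : ∀ A t → A ⊆ infected G r A t
  infected-⊇ A zero    = ⊆-refl
  infected-⊇ A (suc t) = ⊆-trans (infected-⊇ A t) step-inflationary

  closed-or-large : ∀ A t → (∃ λ s → Closed G r (infected G r A s)) ⊎ t ≤ ∣ infected G r A t ∣
  closed-or-large A zero = inj₂ z≤n
  closed-or-large A (suc t) with closed-or-large A t
  ... | inj₁ closed = inj₁ closed
  ... | inj₂ t≤∣Aₜ∣ with closed-or-grows (infected G r A t)
  ...   | inj₁ closed = inj₁ (t , closed)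
  ...   | inj₂ grows  = inj₂ (≤-<-trans t≤∣Aₜ∣ (p⊂q⇒∣p∣<∣q∣ grows))

  -- Since no set exceeds n vertices, the process becomes closed.
  eventually-closed : ∀ A → ∃ λ t → Closed G r (infected G r A t)
  eventually-closed A with closed-or-large A (suc n)
  ... | inj₁ closed = closed
  ... | inj₂ large  = ⊥-elim (n≮n n (≤-trans large (∣p∣≤n (infected G r A (suc n)))))

open Dynamics using (infected-⊇; eventually-closed)

module EdgeCounting {n : ℕ} (G : Graph n) where

  nbrsWhere : Fin n → (Fin n → Bool) → ℕ
  nbrsWhere v q = size (λ w → adj G v w ∧ q w)

  -- A vertex is not its own neighbour, so inside a set q containing v it
  -- sees fewer than size q vertices.
  nbrsWhere-< : ∀ q v → q v ≡ true → nbrsWhere v q < size q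
  nbrsWhere-< q v qv = sum-mono-< (λ w → 𝟙-∧-≤ (adj G v w) (q w)) v at-v
    where
    at-v : 𝟙 (adj G v v ∧ q v) < 𝟙 (q v)
    at-v rewrite irrefl G v | qv = s≤s z≤n

  degree-split : ∀ β v → degree G v ≡ nbrsWhere v β + nbrsWhere v (not ∘ β)
  degree-split β v = begin
    degree G v                     ≡⟨ countWhere≡size (adj G v) ⟩
    size (adj G v)                 ≡⟨ sum-cong-≗ {n} (λ w → 𝟙-split (adj G v w) (β w)) ⟩
    sum (λ w → 𝟙 (adj G v w ∧ β w) + 𝟙 (adj G v w ∧ not (β w)))
                                   ≡⟨ ∑-distrib-+ (λ w → 𝟙 (adj G v w ∧ β w)) (λ w → 𝟙 (adj G v w ∧ not (β w))) ⟩
    nbrsWhere v β + nbrsWhere v (not ∘ β) ∎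
    where open ≡-Reasoning

  inside-degree : ∀ {d} → minDegree≥ G d → ∀ β v → β v ≡ true →
    d + 1 ≤ nbrsWhere v (not ∘ β) + size β
  inside-degree {d} δ β v v∈β = begin
    d + 1                                         ≤⟨ +-monoˡ-≤ 1 (δ v) ⟩
    degree G v + 1                                ≡⟨ cong (_+ 1) (degree-split β v) ⟩
    nbrsWhere v β + nbrsWhere v (not ∘ β) + 1     ≡⟨ rearrange (nbrsWhere v β) (nbrsWhere v (not ∘ β)) ⟩
    nbrsWhere v (not ∘ β) + suc (nbrsWhere v β)   ≤⟨ +-monoʳ-≤ (nbrsWhere v (not ∘ β)) (nbrsWhere-< β v v∈β) ⟩
    nbrsWhere v (not ∘ β) + size β                ∎
    where
    open ≤-Reasoning
    rearrange : ∀ a b → a + b + 1 ≡ b + suc a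
    rearrange a b = solve (a ∷ b ∷ [])

  outside-degree : ∀ {d p} → minDegree≥ G d → ∀ β w → β w ≡ false → nbrsWhere w β ≤ p →
    d + 1 ≤ p + size (not ∘ β)
  outside-degree {d} {p} δ β w w∉β few = begin
    d + 1                                         ≤⟨ +-monoˡ-≤ 1 (δ w) ⟩
    degree G w + 1                                ≡⟨ cong (_+ 1) (degree-split β w) ⟩
    nbrsWhere w β + nbrsWhere w (not ∘ β) + 1     ≡⟨ +-assoc (nbrsWhere w β) _ 1 ⟩
    nbrsWhere w β + (nbrsWhere w (not ∘ β) + 1)   ≤⟨ +-mono-≤ few (≤-trans (≤-reflexive (+-comm _ 1)) (nbrsWhere-< (not ∘ β) w (cong not w∉β))) ⟩
    p + size (not ∘ β)                            ∎
    where open ≤-Reasoning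

  module _ {p : ℕ} (B : Subset n) (closed : Closed G (suc p) B) where

    private
      β : Fin n → Bool
      β = lookup B

    closed-nbrs : ∀ w → β w ≡ false → nbrsWhere w β ≤ p
    closed-nbrs w w∉B = s≤s⁻¹ (subst (_< suc p) (countWhere≡size (λ v → adj G w v ∧ β v)) (closed w w∉B))

    -- Counting the edges between B and V ∖ B from the outside: each outside
    -- vertex has at most p neighbours in B.
    cross-edges-≤ : sum (λ v → 𝟙 (β v) * nbrsWhere v (not ∘ β)) ≤ p * size (not ∘ β)
    cross-edges-≤ = begin
      sum (λ v → 𝟙 (β v) * nbrsWhere v (not ∘ β))
        ≡⟨ sum-cong-≗ {n} (λ v → *-distribˡ-sum (𝟙 (β v)) (λ w → 𝟙 (adj G v w ∧ not (β w)))) ⟩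
      sum (λ v → sum (λ w → 𝟙 (β v) * 𝟙 (adj G v w ∧ not (β w))))
        ≡⟨ ∑-comm (λ v w → 𝟙 (β v) * 𝟙 (adj G v w ∧ not (β w))) ⟩
      sum (λ w → sum (λ v → 𝟙 (β v) * 𝟙 (adj G v w ∧ not (β w))))
        ≡⟨ sum-cong-≗ {n} (λ w → sum-cong-≗ {n} (λ v → edge-from-w v w)) ⟩
      sum (λ w → sum (λ v → 𝟙 (not (β w)) * 𝟙 (adj G w v ∧ β v)))
        ≡⟨ sum-cong-≗ {n} (λ w → *-distribˡ-sum (𝟙 (not (β w))) (λ v → 𝟙 (adj G w v ∧ β v))) ⟨
      sum (λ w → 𝟙 (not (β w)) * nbrsWhere w β)
        ≤⟨ sum-mono (λ w → 𝟙-guard (not (β w)) (λ w∉B → closed-nbrs w (not-injective w∉B))) ⟩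
      sum (λ w → 𝟙 (not (β w)) * p)
        ≡⟨ *-distribʳ-sum p (𝟙 ∘ not ∘ β) ⟨
      size (not ∘ β) * p
        ≡⟨ *-comm (size (not ∘ β)) p ⟩
      p * size (not ∘ β) ∎
      where
      open ≤-Reasoning
      edge-from-w : ∀ v w → 𝟙 (β v) * 𝟙 (adj G v w ∧ not (β w)) ≡ 𝟙 (not (β w)) * 𝟙 (adj G w v ∧ β v)
      edge-from-w v w rewrite sym G v w = 𝟙-swap (β v) (β w) (adj G w v)

    -- Double counting: each vertex of B has at least d + 1 - |B| neighbours
    -- outside B, so  |B|·(d + 1) ≤ p·|V ∖ B| + |B|².
    closed-edge-count : ∀ {d} → minDegree≥ G d → size β * (d + 1) ≤ p * size (not ∘ β) + size β * size β
    closed-edge-count {d} δ = begin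
      size β * (d + 1)
        ≡⟨ *-distribʳ-sum (d + 1) (𝟙 ∘ β) ⟩
      sum (λ v → 𝟙 (β v) * (d + 1))
        ≤⟨ sum-mono (λ v → 𝟙-guard (β v) (inside-degree δ β v)) ⟩
      sum (λ v → 𝟙 (β v) * (nbrsWhere v (not ∘ β) + size β))
        ≡⟨ sum-cong-≗ {n} (λ v → *-distribˡ-+ (𝟙 (β v)) (nbrsWhere v (not ∘ β)) (size β)) ⟩
      sum (λ v → 𝟙 (β v) * nbrsWhere v (not ∘ β) + 𝟙 (β v) * size β)
        ≡⟨ ∑-distrib-+ (λ v → 𝟙 (β v) * nbrsWhere v (not ∘ β)) (λ v → 𝟙 (β v) * size β) ⟩
      sum (λ v → 𝟙 (β v) * nbrsWhere v (not ∘ β)) + sum (λ v → 𝟙 (β v) * size β)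
        ≡⟨ cong (sum (λ v → 𝟙 (β v) * nbrsWhere v (not ∘ β)) +_) (*-distribʳ-sum (size β) (𝟙 ∘ β)) ⟨
      sum (λ v → 𝟙 (β v) * nbrsWhere v (not ∘ β)) + size β * size β
        ≤⟨ +-monoˡ-≤ (size β * size β) cross-edges-≤ ⟩
      p * size (not ∘ β) + size β * size β ∎
      where open ≤-Reasoning

module Arithmetic where

  -- The three counting inequalities, with l = k + p, b = |B|, m = |V ∖ B| and
  -- D = δ + 1, are contradictory.  If b + k ≤ D the edge count is too large;
  -- otherwise D ≤ b + k - 1 combines with D ≤ p + m and the degree condition.
  module _ (k p b m : ℕ) (l≤b : k + p ≤ b) where

    degree-exceeds-l : ∀ {D} → p * (b + m) + (k + p) * k < (k + p) * D → k + p < D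
    degree-exceeds-l {D} dense = *-cancelˡ-< (k + p) (k + p) D (begin-strict
      (k + p) * (k + p)          ≡⟨ solve (k ∷ p ∷ []) ⟩
      p * (k + p) + (k + p) * k  ≤⟨ +-monoˡ-≤ ((k + p) * k) (*-monoʳ-≤ p (≤-trans l≤b (m≤m+n b m))) ⟩
      p * (b + m) + (k + p) * k  <⟨ dense ⟩
      (k + p) * D                ∎)
      where open ≤-Reasoning

    few-outside-edges-impossible : ∀ y →
      p * (b + m) + (k + p) * k < (k + p) * (b + k + y) →
      b * (b + k + y) ≤ p * m + b * b → ⊥
    few-outside-edges-impossible y dense edges = <-irrefl refl (begin-strict
      b * k + b * y         ≡⟨ solve (b ∷ k ∷ y ∷ []) ⟩
      b * (k + y)           ≤⟨ edges′ ⟩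
      p * m                 <⟨ dense′ ⟩
      k * b + (k + p) * y   ≤⟨ +-monoʳ-≤ (k * b) (*-monoˡ-≤ y l≤b) ⟩
      k * b + b * y         ≡⟨ solve (b ∷ k ∷ y ∷ []) ⟩
      b * k + b * y         ∎)
      where
      open ≤-Reasoning
      edges′ : b * (k + y) ≤ p * m
      edges′ = +-cancelˡ-≤ (b * b) _ _ (begin
        b * b + b * (k + y)  ≡⟨ solve (b ∷ k ∷ y ∷ []) ⟩
        b * (b + k + y)      ≤⟨ edges ⟩
        p * m + b * b        ≡⟨ +-comm (p * m) (b * b) ⟩
        b * b + p * m        ∎)
      dense′ : p * m < k * b + (k + p) * y
      dense′ = +-cancelˡ-< (p * b + (k + p) * k) _ _ (begin-strict
        p * b + (k + p) * k + p * m          ≡⟨ solve (k ∷ p ∷ b ∷ m ∷ []) ⟩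
        p * (b + m) + (k + p) * k            <⟨ dense ⟩
        (k + p) * (b + k + y)                ≡⟨ solve (k ∷ p ∷ b ∷ y ∷ []) ⟩
        p * b + (k + p) * k + (k * b + (k + p) * y) ∎)

    large-degree-impossible : ∀ z → k ≤ p →
      p * (b + m) + (k + p) * k < (k + p) * suc (k + p + z) →
      suc (k + p + z) < b + k →
      suc (k + p + z) ≤ p + m → ⊥
    large-degree-impossible z k≤p dense D<b+k D≤p+m =
      m+1+n≰m (p + p * z) (≤-trans excess (+-mono-≤ k≤p (*-monoˡ-≤ z k≤p)))
      where
      open ≤-Reasoning
      excess : p + p * z + suc p ≤ k + k * z
      excess = +-cancelˡ-≤ (2 * p * (k + p) + p + p * z + (k + p) * k) _ _ (begin
        2 * p * (k + p) + p + p * z + (k + p) * k + (p + p * z + suc p)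
                                                  ≡⟨ solve (k ∷ p ∷ z ∷ []) ⟩
        p * suc (suc (k + p + z)) + p * suc (k + p + z) + suc ((k + p) * k)
                                                  ≤⟨ +-monoˡ-≤ _ (+-mono-≤ (*-monoʳ-≤ p D<b+k) (*-monoʳ-≤ p D≤p+m)) ⟩
        p * (b + k) + p * (p + m) + suc ((k + p) * k)
                                                  ≡⟨ solve (k ∷ p ∷ b ∷ m ∷ []) ⟩
        suc (p * (b + m) + (k + p) * k) + p * (k + p)
                                                  ≤⟨ +-monoˡ-≤ (p * (k + p)) dense ⟩
        (k + p) * suc (k + p + z) + p * (k + p)   ≡⟨ solve (k ∷ p ∷ z ∷ []) ⟩
        2 * p * (k + p) + p + p * z + (k + p) * k + (k + k * z)
                                                  ∎)

  no-proper-closed-set : ∀ {k p l b m D} → k + p ≡ l → k ≤ p → l ≤ b →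
    p * (b + m) + l * k < l * D →
    b * D ≤ p * m + b * b →
    D ≤ p + m → ⊥
  no-proper-closed-set {k} {p} {b = b} {m} {D} refl k≤p l≤b dense edges D≤p+m
    with ≤-<-connex (b + k) D
  ... | inj₁ b+k≤D with m≤n⇒∃[o]m+o≡n b+k≤D
  ...   | y , refl = few-outside-edges-impossible k p b m l≤b y dense edges
  no-proper-closed-set {k} {p} {b = b} {m} {D} refl k≤p l≤b dense edges D≤p+m
      | inj₂ D<b+k with m≤n⇒∃[o]m+o≡n (degree-exceeds-l k p b m l≤b dense)
  ...   | z , refl = large-degree-impossible k p b m l≤b z k≤p dense D<b+k D≤p+m

  ceilDiv-< : ∀ a l .{{_ : NonZero l}} → ceilDiv a l * l < a + l
  ceilDiv-< a (suc l′) = ≤-<-trans (m/n*n≤m (a + l′) (suc l′)) (+-monoʳ-< a (n<1+n l′))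

  -- The minimum-degree hypothesis  δ ≥ n - ⌈k·n/l⌉ + k  without division:
  -- with D = δ + 1 it states  p·n + l·k < l·D.
  degree-condition : ∀ {k p l n c D} → k + p ≡ l → c * l < k * n + l → n + k < D + c →
    p * n + l * k < l * D
  degree-condition {k} {p} {n = n} {c} {D} refl ceiling excess =
    +-cancelʳ-< (k * n + (k + p)) _ _ (begin-strict
      p * n + (k + p) * k + (k * n + (k + p))  ≡⟨ solve (k ∷ p ∷ n ∷ []) ⟩
      (k + p) * suc (n + k)                     ≤⟨ *-monoʳ-≤ (k + p) excess ⟩
      (k + p) * (D + c)                         ≡⟨ solve (k ∷ p ∷ D ∷ c ∷ []) ⟩
      (k + p) * D + c * (k + p)                 <⟨ +-monoʳ-< ((k + p) * D) ceiling ⟩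
      (k + p) * D + (k * n + (k + p))           ∎)
    where open ≤-Reasoning

  -- n - c + j + 2 exceeds n - c by more than j + 1, even with truncated subtraction.
  truncated-excess : ∀ n c j → n + (j + 1) < n ∸ c + j + 1 + 1 + c
  truncated-excess n c j = begin-strict
    n + (j + 1)                  ≤⟨ +-monoˡ-≤ (j + 1) (m≤n+m∸n n c) ⟩
    c + (n ∸ c) + (j + 1)        <⟨ ≤-reflexive (rearrange (n ∸ c)) ⟩
    n ∸ c + j + 1 + 1 + c        ∎
    where
    open ≤-Reasoning
    rearrange : ∀ x → suc (c + x + (j + 1)) ≡ x + j + 1 + 1 + c
    rearrange x = solve (c ∷ x ∷ j ∷ [])

open EdgeCounting using (closed-nbrs; outside-degree; closed-edge-count)
open Arithmetic using (no-proper-closed-set; ceilDiv-<; degree-condition; truncated-excess)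

closed-set-is-full : ∀ {n} (G : Graph n) {k p l d} → k + p ≡ l → k ≤ p →
  minDegree≥ G d → p * n + l * k < l * (d + 1) →
  ∀ B → Closed G (suc p) B → l ≤ ∣ B ∣ → B ≡ ⊤
closed-set-is-full G {k} {p} {l} {d} k+p≡l k≤p δ dense B closed l≤∣B∣
  with any? (λ w → lookup B w Bool.≟ false)
... | no none = ⊆-antisym ⊆⊤ (λ {w} _ → lookup⇒[]= w B (¬-not (λ w∉B → none (w , w∉B))))
... | yes (w , w∉B) = ⊥-elim (no-proper-closed-set k+p≡l k≤p l≤b dense′
        (closed-edge-count G B closed δ)
        (outside-degree G δ (lookup B) w w∉B (closed-nbrs G B closed w w∉B)))
  where
  l≤b : l ≤ size (lookup B)
  l≤b = subst (l ≤_) (∣∣≡size B) l≤∣B∣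
  dense′ : p * (size (lookup B) + size (not ∘ lookup B)) + l * k < l * (d + 1)
  dense′ = subst (λ x → p * x + l * k < l * (d + 1)) (≡.sym (size-complement (lookup B))) dense

lemma13 : (r l : ℕ) → 1 ≤ r → .{{_ : NonZero l}} → l ≤ 2 * r ∸ 2 → r ≤ l →
    (n : ℕ) (G : Graph n) →
    minDegree≥ G (n ∸ ceilDiv ((l ∸ r + 1) * n) l + (l ∸ r) + 1) →
    (A₀ : Subset n) → ∣ A₀ ∣ ≡ l → Percolates G r A₀
lemma13 zero _ ()
lemma13 (suc p) l _ l≤2r∸2 r≤l n G δ A₀ ∣A₀∣≡l with eventually-closed G (suc p) A₀
... | t , closed = t , closed-set-is-full G k+p≡l k≤p δ dense (infected G (suc p) A₀ t) closed l≤∣Aₜ∣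
  where
  k = l ∸ suc p + 1
  c = ceilDiv (k * n) l

  k+p≡l : k + p ≡ l
  k+p≡l = ≡.trans (+-assoc (l ∸ suc p) 1 p) (m∸n+n≡m r≤l)

  k≤p : k ≤ p
  k≤p = +-cancelʳ-≤ p k p (begin
    k + p            ≡⟨ k+p≡l ⟩
    l                ≤⟨ l≤2r∸2 ⟩
    2 * suc p ∸ 2    ≡⟨ *-distribˡ-∸ 2 (suc p) 1 ⟨
    2 * p            ≡⟨ cong (p +_) (+-identityʳ p) ⟩
    p + p            ∎)
    where open ≤-Reasoning

  dense : p * n + l * k < l * (n ∸ c + (l ∸ suc p) + 1 + 1)
  dense = degree-condition k+p≡l (ceilDiv-< (k * n) l) (truncated-excess n c (l ∸ suc p))

  l≤∣Aₜ∣ : l ≤ ∣ infected G (suc p) A₀ t ∣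
  l≤∣Aₜ∣ = subst (_≤ ∣ infected G (suc p) A₀ t ∣) ∣A₀∣≡l (p⊆q⇒∣p∣≤∣q∣ (infected-⊇ G (suc p) A₀ t))
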